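{- Let $\mathcal{S}$ be a nonempty semigroup, let $E(\mathcal{S})$ be its set of idempotents, and suppose that $|\mathcal{S}\setminus E(\mathcal{S})|$ is finite. Then every $\mathcal{S}$-valued sequence $T=a_1a_2\cdots a_\ell$ of length $\ell=|\mathcal{S}\setminus E(\mathcal{S})|+1$ is not strongly idempotent-product free; that is, there exist indices $1\le i_1<i_2<\cdots<i_t\le \ell$ with $t\ge 1$ such that $a_{i_1}*a_{i_2}*\cdots*a_{i_t}\in E(\mathcal{S})$.
   Context: A semigroup is a set with an associative binary operation $*$. An element $x$ is an idempotent if $x*x=x$. An $\mathcal{S}$-valued sequence is a finite word $a_1a_2\cdots a_\ell$ (terms may repeat) with $a_i\in\mathcal{S}$; a subsequence is $a_{i_1}\cdots a_{i_t}$ with $1\le i_1<\cdots<i_t\le\ell$. A sequence is strongly idempotent-product free if no nonempty subsequence has the product of its terms, taken in their natural order in the sequence, equal to an idempotent. -}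

module Defs where

open import Level using (Level; _⊔_)
open import Algebra.Bundles using (Semigroup)
open import Data.Nat using (ℕ; zero; suc)
open import Data.Fin using (Fin; zero; suc; _<_)
open import Data.Product using (∃; _×_)
open import Relation.Binary.PropositionalEquality using (_≡_)
open import Relation.Nullary using (¬_)

module _ {c ℓ : Level} (S : Semigroup c ℓ) where
  open Semigroup S

  IsIdempotent : Carrier → Set ℓ
  IsIdempotent x = (x ∙ x) ≈ x

  -- |S \ E(S)| = n : the non-idempotents are enumerated, without
  -- repetition (up to ≈), by some f : Fin n → Carrier.
  NonIdempotentCount : ℕ → Set (c ⊔ ℓ)
  NonIdempotentCount n =
    ∃ λ (f : Fin n → Carrier) →
      (∀ i → ¬ IsIdempotent (f i)) ×
      (∀ i j → f i ≈ f j → i ≡ j) ×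
      (∀ x → ¬ IsIdempotent x → ∃ λ i → f i ≈ x)

  prod : {t : ℕ} → (Fin (suc t) → Carrier) → Carrier
  prod {zero} g = g zero
  prod {suc t} g = g zero ∙ prod (λ i → g (suc i))

  StronglyIdempotentProductFree : {len : ℕ} → (Fin len → Carrier) → Set ℓ
  StronglyIdempotentProductFree {len} a =
    ∀ (t : ℕ) (ι : Fin (suc t) → Fin len) →
      (∀ i j → i < j → ι i < ι j) →
      ¬ IsIdempotent (prod (λ k → a (ι k)))

module Submission where

-- Suppose the sequence a = a₀ ⋯ aₙ is strongly idempotent-product
-- free, where n is the number of non-idempotents of S.  Then every product of
-- a nonempty subsequence is a non-idempotent, so it suffices to exhibit n + 1
-- pairwise distinct such products (pigeonhole).  We show, by induction on the
-- length, that a free sequence of length ℓ has ℓ pairwise distinct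
-- subsequence products.  The inductive step needs one product of a that is
-- not a product of its tail a₁ ⋯ aₙ.  If there were none, then by induction
-- on m every power a₀^(m+1) would be a product of the tail (a₀ times a
-- product of the tail is a product of a), hence a non-idempotent; but in a
-- semigroup with finitely many non-idempotents some power of every element is
-- idempotent, since two of its first n + 1 powers coincide and the powers are
-- then eventually periodic.  As the equality of S is not decidable, the
-- existence claims of the induction are proved in double-negated form, which
-- suffices for a negative conclusion.

open import Defs
open import Level using (Level; _⊔_)
open import Algebra.Bundles using (Semigroup)
open import Data.Nat using (ℕ; zero; suc; _+_; _*_; _∸_; z≤n; s≤s)
open import Data.Nat.Properties using (+-suc; m+[n∸m]≡n; n<1+n)
open import Data.Nat.Tactic.RingSolver using (solve-∀)
open import Data.Fin using (Fin; zero; suc; toℕ; _<_)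
open import Data.Fin.Properties using (pigeonhole; <⇒≢)
open import Data.Vec.Functional using (head; tail; _∷_)
open import Data.Product using (∃; ∃₂; _×_; _,_; proj₁; proj₂)
open import Data.Empty using (⊥-elim)
open import Relation.Nullary using (¬_)
open import Relation.Binary.PropositionalEquality as ≡ using (_≡_; refl)

-- Exponent arithmetic for the periodicity argument (p = 1 + d is the period).
add-period : ∀ i d q r → (q * suc d + r) + (i + suc d) ≡ (suc q * suc d + r) + i
add-period = solve-∀

double-exponent : ∀ i d → suc (((d + i * d) + i) + ((d + i * d) + i))
                        ≡ (suc i * suc d + (d + i * d)) + i
double-exponent = solve-∀

module _ {c ℓ : Level} (S : Semigroup c ℓ) where
  open Semigroup S renaming (refl to ≈-refl)

  Idempotent : Carrier → Set ℓ
  Idempotent = IsIdempotent S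

  idempotent-resp : ∀ {x y} → x ≈ y → Idempotent x → Idempotent y
  idempotent-resp x≈y xx≈x = trans (∙-cong (sym x≈y) (sym x≈y)) (trans xx≈x x≈y)

  -- Powers with positive exponent: power x k = x ^ (1 + k).
  power : Carrier → ℕ → Carrier
  power x zero    = x
  power x (suc k) = x ∙ power x k

  power-cong : ∀ x {k m} → k ≡ m → power x k ≈ power x m
  power-cong x refl = ≈-refl

  power-add : ∀ x k m → power x k ∙ power x m ≈ power x (suc (k + m))
  power-add x zero    m = ≈-refl
  power-add x (suc k) m = trans (assoc x (power x k) (power x m)) (∙-congˡ (power-add x k m))

  -- If x^(1+i) = x^(1+i+p) with p = 1 + d, then from exponent 1 + i on the
  -- powers of x are periodic with period p, and x^(p(1+i)) is idempotent.
  module Periodic (x : Carrier) (i d : ℕ) (period : power x i ≈ power x (i + suc d)) where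

    shift : ∀ r → power x (r + i) ≈ power x (r + (i + suc d))
    shift zero    = period
    shift (suc r) = ∙-congˡ (shift r)

    shift-many : ∀ q r → power x (r + i) ≈ power x ((q * suc d + r) + i)
    shift-many zero    r = ≈-refl
    shift-many (suc q) r =
      trans (shift-many q r) (trans (shift (q * suc d + r)) (power-cong x (add-period i d q r)))

    -- The exponent 1 + e with e = d + i * d + i equals p * (1 + i).
    e : ℕ
    e = (d + i * d) + i

    idempotent-power : Idempotent (power x e)
    idempotent-power =
      trans (power-add x e e)
            (trans (power-cong x (double-exponent i d)) (sym (shift-many (suc i) (d + i * d))))

  collision : ∀ {n} → NonIdempotentCount S n →
              (g : Fin (suc n) → Carrier) → (∀ k → ¬ Idempotent (g k)) →
              ∃₂ λ i j → i < j × g i ≈ g j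
  collision {n} (f , _ , _ , onto) g g-non with pigeonhole (n<1+n n) index
    where index : Fin (suc n) → Fin n
          index k = proj₁ (onto (g k) (g-non k))
  ... | i , j , i<j , same-index =
    i , j , i<j , trans (sym (label i)) (trans (reflexive (≡.cong f same-index)) (label j))
    where label : ∀ k → f (proj₁ (onto (g k) (g-non k))) ≈ g k
          label k = proj₂ (onto (g k) (g-non k))

  some-power-idempotent : ∀ {n} → NonIdempotentCount S n →
                          ∀ x → ¬ (∀ m → ¬ Idempotent (power x m))
  some-power-idempotent count x non with collision count (λ k → power x (toℕ k)) (λ k → non (toℕ k))
  ... | i , j , i<j , equal = non e idempotent-power
    where
    d : ℕ
    d = toℕ j ∸ suc (toℕ i)
    j≡i+1+d : toℕ j ≡ toℕ i + suc d
    j≡i+1+d = ≡.sym (≡.trans (+-suc (toℕ i) d) (m+[n∸m]≡n i<j))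
    period : power x (toℕ i) ≈ power x (toℕ i + suc d)
    period = trans equal (power-cong x j≡i+1+d)
    open Periodic x (toℕ i) d period using (e; idempotent-power)

  data SubProduct : {len : ℕ} → (Fin len → Carrier) → Carrier → Set (c ⊔ ℓ) where
    first : ∀ {l} {a : Fin (suc l) → Carrier} → SubProduct a (head a)
    skip  : ∀ {l} {a : Fin (suc l) → Carrier} {z} → SubProduct (tail a) z → SubProduct a z
    cons  : ∀ {l} {a : Fin (suc l) → Carrier} {z} → SubProduct (tail a) z → SubProduct a (head a ∙ z)

  subProduct-sound : ∀ {len} {a : Fin len → Carrier} {z} → SubProduct a z →
    ∃₂ λ t (ι : Fin (suc t) → Fin len) →
      (∀ i j → i < j → ι i < ι j) × prod S (λ k → a (ι k)) ≡ z
  subProduct-sound first = 0 , (λ _ → zero) , (λ { zero zero () }) , refl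
  subProduct-sound (skip p) with subProduct-sound p
  ... | t , ι , increasing , product = t , (λ k → suc (ι k)) , (λ i j i<j → s≤s (increasing i j i<j)) , product
  subProduct-sound (cons p) with subProduct-sound p
  ... | t , ι , increasing , product = suc t , zero ∷ (λ k → suc (ι k)) , increasing′ , ≡.cong (_ ∙_) product
    where
    increasing′ : ∀ i j → i < j → (zero ∷ (λ k → suc (ι k))) i < (zero ∷ (λ k → suc (ι k))) j
    increasing′ zero    (suc j) _         = s≤s z≤n
    increasing′ (suc i) (suc j) (s≤s i<j) = s≤s (increasing i j i<j)

  Free : {len : ℕ} → (Fin len → Carrier) → Set (c ⊔ ℓ)
  Free a = ∀ z → SubProduct a z → ¬ Idempotent z

  free-tail : ∀ {l} {a : Fin (suc l) → Carrier} → Free a → Free (tail a)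
  free-tail free z p = free z (skip p)

  stronglyFree⇒free : ∀ {len} (a : Fin len → Carrier) → StronglyIdempotentProductFree S a → Free a
  stronglyFree⇒free a strongly z p z-idem with subProduct-sound p
  ... | t , ι , increasing , product = strongly t ι increasing (≡.subst Idempotent (≡.sym product) z-idem)

  SubProduct≈ : {len : ℕ} → (Fin len → Carrier) → Carrier → Set (c ⊔ ℓ)
  SubProduct≈ a x = ∃ λ w → SubProduct a w × w ≈ x

  -- A free sequence has (not not) a subsequence product that is not one of
  -- its tail: otherwise all powers of its head would be non-idempotent.
  new-product : ∀ {n} → NonIdempotentCount S n →
                ∀ {l} (a : Fin (suc l) → Carrier) → Free a →
                ¬ ¬ (∃ λ x → SubProduct a x × ¬ SubProduct≈ (tail a) x)
  new-product count a free no-new = some-power-idempotent count (head a) powers-non-idempotent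
    where
    in-tail : ∀ x → SubProduct a x → ¬ ¬ SubProduct≈ (tail a) x
    in-tail x p not-in-tail = no-new (x , p , not-in-tail)

    powers-in-tail : ∀ m → ¬ ¬ SubProduct≈ (tail a) (power (head a) m)
    powers-in-tail zero = in-tail _ first
    powers-in-tail (suc m) not-in-tail = powers-in-tail m λ { (w , p , w≈) →
      in-tail (head a ∙ w) (cons p) λ { (w′ , p′ , w′≈) →
        not-in-tail (w′ , p′ , trans w′≈ (∙-congˡ w≈)) } }

    powers-non-idempotent : ∀ m → ¬ Idempotent (power (head a) m)
    powers-non-idempotent m idem = powers-in-tail m λ { (w , p , w≈) →
      free w (skip p) (idempotent-resp (sym w≈) idem) }

  DistinctSubProducts : {len : ℕ} → (Fin len → Carrier) → Set (c ⊔ ℓ)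
  DistinctSubProducts {len} a =
    ∃ λ (e : Fin len → Carrier) → (∀ k → SubProduct a (e k)) × (∀ k k′ → e k ≈ e k′ → k ≡ k′)

  extend-distinct : ∀ {l} {a : Fin (suc l) → Carrier} x → SubProduct a x →
                    ¬ SubProduct≈ (tail a) x → DistinctSubProducts (tail a) → DistinctSubProducts a
  extend-distinct x p new (e , e-sub , e-inj) =
    x ∷ e , (λ { zero → p ; (suc k) → skip (e-sub k) }) , injective
    where
    injective : ∀ k k′ → (x ∷ e) k ≈ (x ∷ e) k′ → k ≡ k′
    injective zero    zero     _  = refl
    injective zero    (suc k′) eq = ⊥-elim (new (e k′ , e-sub k′ , sym eq))
    injective (suc k) zero     eq = ⊥-elim (new (e k , e-sub k , eq))
    injective (suc k) (suc k′) eq = ≡.cong suc (e-inj k k′ eq)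

  distinct-subProducts : ∀ {n} → NonIdempotentCount S n →
                         ∀ {len} (a : Fin len → Carrier) → Free a → ¬ ¬ DistinctSubProducts a
  distinct-subProducts count {zero}  a free none = none ((λ ()) , (λ ()) , (λ ()))
  distinct-subProducts count {suc l} a free none =
    distinct-subProducts count (tail a) (free-tail free) λ distinct-tail →
      new-product count a free λ { (x , p , new) → none (extend-distinct x p new distinct-tail) }

proposition1p1 : {c ℓ : Level} (S : Semigroup c ℓ) →
    Semigroup.Carrier S →
    (n : ℕ) → NonIdempotentCount S n →
    (a : Fin (suc n) → Semigroup.Carrier S) →
    ¬ StronglyIdempotentProductFree S a
proposition1p1 S _ n count a strongly =
  distinct-subProducts S count a free λ { (e , e-sub , e-inj) →
    let i , j , i<j , e-i≈e-j = collision S count e (λ k → free (e k) (e-sub k))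
    in <⇒≢ i<j (e-inj i j e-i≈e-j) }
  where
  free : Free S a
  free = stronglyFree⇒free S a strongly
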